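{- Let $k\ge1$, $p\ge0$ be integers, let $\lambda=(k,1^p)$, viewed as the diagram $\{(1,1),\dots,(1,k)\}\cup\{(2,1),\dots,(p+1,1)\}$, and let $\theta$ be any type of shape $\lambda$. Then $|\mathrm{Tab}(\theta)|=f^{\lambda}$, the number of standard Young tableaux of shape $\lambda$.
   Context: A diagram is a finite subset $S\subset\mathbb N_{>0}^2$; $(a,b)$ is the box in row $a$, column $b$. Arm $A_S(a,b)=\{(a,k)\in S:k>b\}$, leg $L_S(a,b)=\{(k,b)\in S:k\ge a\}$, hook $H_S=A_S\cup L_S$, $h_S=|H_S|$. A tableau of shape $S$ ($|S|=n$) is a bijection $t:S\to\{1,\dots,n\}$. A type of shape $S$ is a map $\theta:S\to\mathbb Z$ with $0\le\theta(\mathfrak c)\le h_S(\mathfrak c)-1$. The type of a tableau $T$ is $\mathfrak c\mapsto|\{\mathfrak d\in H_S(\mathfrak c):t_{\mathfrak d}<t_{\mathfrak c}\}|$; $\mathrm{Tab}(\theta)$ is the set of tableaux of shape $S$ of type $\theta$. -}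

module Defs where

open import Data.Bool using (Bool; true; false; _∧_; _∨_; not)
open import Data.Nat using (ℕ; zero; suc; _≡ᵇ_; _<ᵇ_; _≤ᵇ_)
open import Data.Product using (_×_; _,_)
open import Data.Fin using (Fin; toℕ)
open import Data.Fin.Properties using () renaming (_≟_ to _≟ᶠ_)
open import Data.List using (List; []; _∷_; length; filterᵇ; map; concatMap; allFin)
open import Data.Bool.ListAction using (and)
open import Data.Vec using (Vec; []; _∷_; lookup; tabulate; _++_)
open import Data.Integer using (ℤ; +_; _-_; _≤_; 0ℤ; 1ℤ)
open import Data.Integer.Properties using () renaming (_≟_ to _≟ℤ_)
open import Relation.Nullary using (does)

-- A cell (a , b) : box in row a, column b (rows/columns numbered from 1).
Cell : Set
Cell = ℕ × ℕ

-- A diagram with n boxes is given by an enumeration S : Vec Cell n of its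
-- (distinct) boxes; box number i is  lookup S i.

inArm : Cell → Cell → Bool
inArm (a , b) (a' , b') = (a' ≡ᵇ a) ∧ (b <ᵇ b')

inLeg : Cell → Cell → Bool
inLeg (a , b) (a' , b') = (b' ≡ᵇ b) ∧ (a ≤ᵇ a')

inHook : Cell → Cell → Bool
inHook c d = inArm c d ∨ inLeg c d

countFin : ∀ {n} → (Fin n → Bool) → ℕ
countFin {n} P = length (filterᵇ P (allFin n))

allFinᵇ : ∀ {n} → (Fin n → Bool) → Bool
allFinᵇ {n} P = and (map P (allFin n))

hookLen : ∀ {n} → Vec Cell n → Fin n → ℕ
hookLen S i = countFin (λ j → inHook (lookup S i) (lookup S j))

IsType : ∀ {n} → Vec Cell n → (Fin n → ℤ) → Set
IsType {n} S θ = (i : Fin n) → (0ℤ ≤ θ i) × (θ i ≤ (+ hookLen S i) - 1ℤ)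

-- A filling t : S → {1,…,n}, with value v : Fin n standing for the number v+1.
-- All fillings are enumerated by allFillings n n.
allVecs : (n m : ℕ) → List (Vec (Fin m) n)
allVecs zero m = [] ∷ []
allVecs (suc n) m = concatMap (λ v → map (_∷ v) (allFin m)) (allVecs n m)

-- t is a bijection S → {1..n}  (injective map between sets of size n)
isBijᵇ : ∀ {n} → Vec (Fin n) n → Bool
isBijᵇ t = allFinᵇ (λ i → allFinᵇ (λ j →
             does (i ≟ᶠ j) ∨ not (does (lookup t i ≟ᶠ lookup t j))))

typeOf : ∀ {n} → Vec Cell n → Vec (Fin n) n → Fin n → ℕ
typeOf S t i = countFin (λ j → inHook (lookup S i) (lookup S j)
                                ∧ (toℕ (lookup t j) <ᵇ toℕ (lookup t i)))

hasTypeᵇ : ∀ {n} → Vec Cell n → (Fin n → ℤ) → Vec (Fin n) n → Bool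
hasTypeᵇ S θ t = allFinᵇ (λ i → does ((+ typeOf S t i) ≟ℤ θ i))

countList : {A : Set} → (A → Bool) → List A → ℕ
countList P xs = length (filterᵇ P xs)

numTab : ∀ {n} → Vec Cell n → (Fin n → ℤ) → ℕ
numTab {n} S θ = countList (λ t → isBijᵇ t ∧ hasTypeᵇ S θ t) (allVecs n n)

isSYTᵇ : ∀ {n} → Vec Cell n → Vec (Fin n) n → Bool
isSYTᵇ S t = isBijᵇ t ∧ allFinᵇ (λ i → allFinᵇ (λ j → mono (lookup S i) (lookup S j) i j))
  where
  mono : Cell → Cell → Fin _ → Fin _ → Bool
  mono (a , b) (a' , b') i j =
    not (((a ≡ᵇ a') ∧ (b <ᵇ b')) ∨ ((b ≡ᵇ b') ∧ (a <ᵇ a')))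
    ∨ (toℕ (lookup t i) <ᵇ toℕ (lookup t j))

numSYT : ∀ {n} → Vec Cell n → ℕ
numSYT {n} S = countList (isSYTᵇ S) (allVecs n n)

hookDiagram : (k p : ℕ) → Vec Cell (k Data.Nat.+ p)
hookDiagram k p = tabulate {n = k} (λ j → (1 , suc (toℕ j))) ++ tabulate {n = p} (λ i → (2 Data.Nat.+ toℕ i , 1))

-- Two moves preserve |Tab(θ)|.  Exchanging the entries v and v + 1 of every tableau lowers the
-- type of the corner by one: its hook is the whole diagram, so its type is its entry, and it lies
-- in no other hook.  Exchanging the entries of consecutive cells a, a′ of the arm (or of the leg),
-- whose hooks agree away from {a, a′}, maps Tab(θ) onto Tab(θ′) with θ′(a) = θ(a′) and
-- θ′(a′) = θ(a) - 1 whenever θ(a′) < θ(a).  Both moves lower Σθ, and one of them applies as long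
-- as θ ≠ 0 (the last cell of the arm or leg has type 0), so |Tab(θ)| = |Tab(0)|; the tableaux of
-- type 0 are exactly the standard ones.

module Submission where

open import Defs
open import Algebra.Definitions using (Involutive)
open import Data.Bool using (Bool; true; false; T; _∧_; _∨_; not; if_then_else_)
open import Data.Bool.ListAction using (and)
open import Data.Bool.Properties using (T-∧; T-≡; T-∨)
open import Data.Empty using (⊥-elim)
open import Data.Fin using (Fin; zero; suc; toℕ; punchIn; punchOut; fromℕ<; reduce≥)
open import Data.Fin.Permutation using (Permutation′; _⟨$⟩ʳ_; permutation)
open import Data.Fin.Properties
  using (toℕ<n; toℕ-injective; toℕ-fromℕ<; punchInᵢ≢i; punchOut-injective; injective⇒≤; any?; all?; ¬∀⟶∃¬)
  renaming (_≟_ to _≟ᶠ_)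
open import Data.Integer as ℤ using (ℤ; +_; ∣_∣; 1ℤ; +≤+)
open import Data.Integer.Properties using (+-injective; 0≤i⇒+∣i∣≡i) renaming (_≟_ to _≟ℤ_)
open import Data.List as List using (List; []; _∷_; length; filterᵇ; concatMap; allFin)
open import Data.List.Properties using (map-++; map-tabulate; map-cong)
open import Data.Nat using (ℕ; zero; suc; _+_; _∸_; _≤_; _<_; _≥_; z≤n; s≤s; s≤s⁻¹; z<s; s<s; s<s⁻¹; _≡ᵇ_; _<ᵇ_; _≤ᵇ_)
open import Data.Nat.ListAction using () renaming (sum to listSum)
open import Data.Nat.ListAction.Properties using (sum-++)
open import Data.Nat.Properties
open import Data.Product using (_×_; _,_; ∃; ∃₂; proj₁; proj₂; uncurry)
import Data.Product
open import Data.Sum using (_⊎_; inj₁; inj₂) renaming ([_,_] to either)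
import Data.Sum
open import Data.Vec as Vec using (Vec; []; _∷_; lookup; tabulate)
open import Data.Vec.Functional using (updateAt)
open import Data.Vec.Functional.Properties using (updateAt-updates; updateAt-minimal)
open import Data.Vec.Properties using (lookup-map; lookup-++-<; lookup-++-≥; lookup∘tabulate)
open import Function using (_∘_; _∘₂_; id; flip; _⇔_; mk⇔; Equivalence)
open import Function.Definitions using (Injective)
open import Function.Properties.Equivalence using () renaming (sym to ⇔-sym; trans to ⇔-trans)
open import Relation.Binary.PropositionalEquality
open import Relation.Nullary using (¬_; yes; no; Dec; does)

open import Algebra.Properties.CommutativeMonoid.Sum +-0-commutativeMonoid
  using (sum; sum-cong-≗; sum-remove; ∑-comm; ∑-permute)

open Equivalence using (to; from)

bool-ext : ∀ {b c : Bool} → (T b → T c) → (T c → T b) → b ≡ c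
bool-ext {false} {false} _   _   = refl
bool-ext {false} {true}  _   c⇒b = ⊥-elim (c⇒b _)
bool-ext {true}  {false} b⇒c _   = ⊥-elim (b⇒c _)
bool-ext {true}  {true}  _   _   = refl

¬T⇒≡false : ∀ {b} → ¬ T b → b ≡ false
¬T⇒≡false {false} _  = refl
¬T⇒≡false {true}  ¬b = ⊥-elim (¬b _)

T-≡ᵇ : ∀ {m n} → T (m ≡ᵇ n) ⇔ m ≡ n
T-≡ᵇ {m} {n} = mk⇔ (≡ᵇ⇒≡ m n) (≡⇒≡ᵇ m n)

T-<ᵇ : ∀ {m n} → T (m <ᵇ n) ⇔ m < n
T-<ᵇ {m} {n} = mk⇔ (<ᵇ⇒< m n) <⇒<ᵇ

T-≤ᵇ : ∀ {m n} → T (m ≤ᵇ n) ⇔ m ≤ n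
T-≤ᵇ {m} {n} = mk⇔ (≤ᵇ⇒≤ m n) ≤⇒≤ᵇ

T-does : ∀ {A : Set} (a? : Dec A) → T (does a?) ⇔ A
T-does (yes a)  = mk⇔ (λ _ → a) (λ _ → _)
T-does (no ¬a) = mk⇔ (λ ()) (λ a → ¬a a)

T-not-does : ∀ {A : Set} (a? : Dec A) → T (not (does a?)) ⇔ (¬ A)
T-not-does (yes a)  = mk⇔ (λ ()) (λ ¬a → ¬a a)
T-not-does (no ¬a) = mk⇔ (λ _ → ¬a) (λ _ → _)

T-and-tabulate : ∀ {n} {A : Set} (P : A → Bool) (f : Fin n → A) →
  T (and (List.map P (List.tabulate f))) ⇔ (∀ i → T (P (f i)))
T-and-tabulate {zero}  P f = mk⇔ (λ _ ()) (λ _ → _)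
T-and-tabulate {suc n} P f = mk⇔
  (λ all → let head , tail = T-∧ .to all in λ { zero → head ; (suc i) → T-and-tabulate P (f ∘ suc) .to tail i })
  (λ all → T-∧ .from (all zero , T-and-tabulate P (f ∘ suc) .from (all ∘ suc)))

T-allFinᵇ : ∀ {n} (P : Fin n → Bool) → T (allFinᵇ P) ⇔ (∀ i → T (P i))
T-allFinᵇ P = T-and-tabulate P id

indicator : Bool → ℕ
indicator b = if b then 1 else 0

indicator-true : ∀ {b} → T b → indicator b ≡ 1
indicator-true {true} _ = refl

indicator-false : ∀ {b} → ¬ T b → indicator b ≡ 0
indicator-false {false} _ = refl
indicator-false {true}  ¬b = ⊥-elim (¬b _)

indicator-mono : ∀ {b c : Bool} → (T b → T c) → indicator b ≤ indicator c
indicator-mono {false}         _   = z≤n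
indicator-mono {true}  {true}  _   = ≤-refl
indicator-mono {true}  {false} b⇒c = ⊥-elim (b⇒c _)

count : ∀ {n} → (Fin n → Bool) → ℕ
count P = sum (indicator ∘ P)

length-filterᵇ-tabulate : ∀ {n} {A : Set} (P : A → Bool) (f : Fin n → A) →
  length (filterᵇ P (List.tabulate f)) ≡ count (P ∘ f)
length-filterᵇ-tabulate {zero} P f = refl
length-filterᵇ-tabulate {suc n} P f with P (f zero)
... | true  = cong suc (length-filterᵇ-tabulate P (f ∘ suc))
... | false = length-filterᵇ-tabulate P (f ∘ suc)

countFin≡count : ∀ {n} (P : Fin n → Bool) → countFin P ≡ count P
countFin≡count P = length-filterᵇ-tabulate P id

sum-mono : ∀ {n} {f g : Fin n → ℕ} → (∀ i → f i ≤ g i) → sum f ≤ sum g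
sum-mono {zero}  f≤g = z≤n
sum-mono {suc n} f≤g = +-mono-≤ (f≤g zero) (sum-mono (f≤g ∘ suc))

sum-update-≤ : ∀ {n} (f g : Fin n → ℕ) (a : Fin n) → (∀ i → i ≢ a → f i ≤ g i) →
  sum f + g a ≤ sum g + f a
sum-update-≤ {suc n} f g a f≤g = begin
  sum f + g a                               ≡⟨ cong (_+ g a) (sum-remove {i = a} f) ⟩
  f a + sum (f ∘ punchIn a) + g a           ≤⟨ +-monoˡ-≤ (g a) (+-monoʳ-≤ (f a) rest≤) ⟩
  f a + sum (g ∘ punchIn a) + g a           ≡⟨ +-comm (f a + _) (g a) ⟩
  g a + (f a + sum (g ∘ punchIn a))         ≡⟨ cong (λ x → g a + x) (+-comm (f a) _) ⟩
  g a + (sum (g ∘ punchIn a) + f a)         ≡⟨ +-assoc (g a) _ (f a) ⟨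
  g a + sum (g ∘ punchIn a) + f a           ≡⟨ cong (_+ f a) (sum-remove {i = a} g) ⟨
  sum g + f a                               ∎
  where
  open ≤-Reasoning
  rest≤ : sum (f ∘ punchIn a) ≤ sum (g ∘ punchIn a)
  rest≤ = sum-mono (λ j → f≤g (punchIn a j) (punchInᵢ≢i a j))

sum-update : ∀ {n} (f g : Fin n → ℕ) (a : Fin n) → (∀ i → i ≢ a → f i ≡ g i) →
  sum f + g a ≡ sum g + f a
sum-update f g a f≡g = ≤-antisym
  (sum-update-≤ f g a (λ i i≢a → ≤-reflexive (f≡g i i≢a)))
  (sum-update-≤ g f a (λ i i≢a → ≤-reflexive (sym (f≡g i i≢a))))

count-cong : ∀ {n} {P Q : Fin n → Bool} → (∀ i → P i ≡ Q i) → count P ≡ count Q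
count-cong P≗Q = sum-cong-≗ (cong indicator ∘ P≗Q)

count-mono : ∀ {n} {P Q : Fin n → Bool} → (∀ i → T (P i) → T (Q i)) → count P ≤ count Q
count-mono P⇒Q = sum-mono (indicator-mono ∘ P⇒Q)

count-permute : ∀ {n} (P : Fin n → Bool) (π : Permutation′ n) → count (P ∘ (π ⟨$⟩ʳ_)) ≡ count P
count-permute P π = sym (∑-permute (indicator ∘ P) π)

count-update-≤ : ∀ {n} (P Q : Fin n → Bool) (a : Fin n) → (∀ i → i ≢ a → T (P i) → T (Q i)) →
  count P + indicator (Q a) ≤ count Q + indicator (P a)
count-update-≤ P Q a P⇒Q = sum-update-≤ _ _ a (λ i i≢a → indicator-mono (P⇒Q i i≢a))

count-update : ∀ {n} (P Q : Fin n → Bool) (a : Fin n) → (∀ i → i ≢ a → P i ≡ Q i) →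
  count P + indicator (Q a) ≡ count Q + indicator (P a)
count-update P Q a P≡Q = sum-update _ _ a (λ i i≢a → cong indicator (P≡Q i i≢a))

count≡0⇒¬T : ∀ {n} (P : Fin n → Bool) → count P ≡ 0 → ∀ i → ¬ T (P i)
count≡0⇒¬T P count≡0 zero with P zero
... | false = λ ()
count≡0⇒¬T P count≡0 (suc i) with P zero
... | false = count≡0⇒¬T (P ∘ suc) count≡0 i

count-none : ∀ {n} (P : Fin n → Bool) → (∀ i → ¬ T (P i)) → count P ≡ 0
count-none {zero}  P none = refl
count-none {suc n} P none with P zero | none zero
... | true  | ¬⊤ = ⊥-elim (¬⊤ _)
... | false | _  = count-none (P ∘ suc) (none ∘ suc)

count-all : ∀ {n} → count {n} (λ _ → true) ≡ n
count-all {zero}  = refl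
count-all {suc n} = cong suc (count-all {n})

count-below : ∀ {n} x → x ≤ n → count {n} (λ i → toℕ i <ᵇ x) ≡ x
count-below {n}     zero    _         = count-none {n} _ (λ _ ())
count-below {suc n} (suc x) (s≤s x≤n) = cong suc (count-below {n} x x≤n)

count-interval : ∀ {n} (P : Fin n → Bool) lo hi →
  (∀ i → T (P i) → lo ≤ toℕ i × toℕ i < hi) → count P ≤ hi ∸ lo
count-interval {zero}  P lo hi inside = z≤n
count-interval {suc n} P lo hi inside with P zero in eq
... | true with inside zero (subst T (sym eq) _)
...   | z≤n , 0<hi = ≤-trans (s≤s tail≤) (≤-reflexive (m+[n∸m]≡n 0<hi))
  where
  tail≤ : count (P ∘ suc) ≤ hi ∸ 1
  tail≤ = count-interval (P ∘ suc) 0 (hi ∸ 1)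
    (λ i Pi → z≤n , ∸-monoˡ-≤ 1 (proj₂ (inside (suc i) Pi)))
count-interval {suc n} P lo hi inside | false = ≤-trans tail≤ (shift lo hi)
  where
  tail≤ : count (P ∘ suc) ≤ hi ∸ 1 ∸ (lo ∸ 1)
  tail≤ = count-interval (P ∘ suc) (lo ∸ 1) (hi ∸ 1)
    (λ i Pi → let lo≤ , <hi = inside (suc i) Pi in ∸-monoˡ-≤ 1 lo≤ , ∸-monoˡ-≤ 1 <hi)
  shift : ∀ lo hi → hi ∸ 1 ∸ (lo ∸ 1) ≤ hi ∸ lo
  shift zero     hi       = m∸n≤m hi 1
  shift (suc lo) zero     = ≤-reflexive (0∸n≡0 lo)
  shift (suc lo) (suc hi) = ≤-refl

injective⇒surjective : ∀ {n} (f : Fin n → Fin n) → (∀ {i j} → f i ≡ f j → i ≡ j) → ∀ y → ∃ λ x → f x ≡ y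
injective⇒surjective {suc m} f f-inj y with any? (λ x → f x ≟ᶠ y)
... | yes hit  = hit
... | no  miss = ⊥-elim (<-irrefl refl (injective⇒≤ {f = g} g-inj))
  where
  g : Fin (suc m) → Fin m
  g x = punchOut {i = y} {j = f x} (λ y≡fx → miss (x , sym y≡fx))
  g-inj : ∀ {a b} → g a ≡ g b → a ≡ b
  g-inj {a} {b} ga≡gb = f-inj (punchOut-injective {i = y} (λ e → miss (a , sym e)) (λ e → miss (b , sym e)) ga≡gb)

injective⇒permutation : ∀ {n} (f : Fin n → Fin n) → (∀ {i j} → f i ≡ f j → i ≡ j) → Permutation′ n
injective⇒permutation f f-inj = permutation f (proj₁ ∘ surj) (proj₂ ∘ surj) (λ x → f-inj (proj₂ (surj (f x))))
  where surj = injective⇒surjective f f-inj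

-- The transposition of i and i + 1; the identity when i + 1 is out of range.
swapFin : ∀ {n} → ℕ → Fin n → Fin n
swapFin {suc zero}    zero    zero          = zero
swapFin {suc (suc n)} zero    zero          = suc zero
swapFin {suc (suc n)} zero    (suc zero)    = zero
swapFin {suc (suc n)} zero    (suc (suc j)) = suc (suc j)
swapFin               (suc i) zero          = zero
swapFin               (suc i) (suc j)       = suc (swapFin i j)

swapFin-involutive : ∀ {n} i → Involutive _≡_ (swapFin {n} i)
swapFin-involutive {suc zero}    zero    zero          = refl
swapFin-involutive {suc (suc n)} zero    zero          = refl
swapFin-involutive {suc (suc n)} zero    (suc zero)    = refl
swapFin-involutive {suc (suc n)} zero    (suc (suc j)) = refl
swapFin-involutive               (suc i) zero          = refl
swapFin-involutive               (suc i) (suc j)       = cong suc (swapFin-involutive i j)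

swapFin-permutation : ∀ {n} → ℕ → Permutation′ n
swapFin-permutation i = permutation (swapFin i) (swapFin i) (swapFin-involutive i) (swapFin-involutive i)

toℕ-swapFin-left : ∀ {n} i (j : Fin n) → toℕ j ≡ i → suc i < n → toℕ (swapFin i j) ≡ suc i
toℕ-swapFin-left {suc (suc n)} zero    zero    refl _         = refl
toℕ-swapFin-left {suc n}       (suc i) (suc j) j≡i  (s≤s i<n) =
  cong suc (toℕ-swapFin-left i j (suc-injective j≡i) i<n)

toℕ-swapFin-right : ∀ {n} i (j : Fin n) → toℕ j ≡ suc i → toℕ (swapFin i j) ≡ i
toℕ-swapFin-right {suc (suc n)} zero    (suc zero) refl = refl
toℕ-swapFin-right {suc n}       (suc i) (suc j)    j≡i  = cong suc (toℕ-swapFin-right i j (suc-injective j≡i))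

swapFin-other : ∀ {n} i (j : Fin n) → toℕ j ≢ i → toℕ j ≢ suc i → swapFin i j ≡ j
swapFin-other {suc zero}    zero    zero          _   _   = refl
swapFin-other {suc (suc n)} zero    zero          j≢i _   = ⊥-elim (j≢i refl)
swapFin-other {suc (suc n)} zero    (suc zero)    _   j≢i = ⊥-elim (j≢i refl)
swapFin-other {suc (suc n)} zero    (suc (suc j)) _   _   = refl
swapFin-other               (suc i) zero          _   _   = refl
swapFin-other               (suc i) (suc j)       j≢i j≢i′ =
  cong suc (swapFin-other i j (j≢i ∘ cong suc) (j≢i′ ∘ cong suc))

data Role (i : ℕ) (x : ℕ) : Set where
  left  : x ≡ i → Role i x
  right : x ≡ suc i → Role i x
  fixed : x ≢ i → x ≢ suc i → Role i x

role : ∀ i x → Role i x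
role i x with x ≟ i | x ≟ suc i
... | yes x≡i | _         = left x≡i
... | no  x≢i | yes x≡1+i = right x≡1+i
... | no  x≢i | no  x≢1+i = fixed x≢i x≢1+i

1+i<ᵇ≡i<ᵇ : ∀ i y → y ≢ suc i → (suc i <ᵇ y) ≡ (i <ᵇ y)
1+i<ᵇ≡i<ᵇ i y y≢1+i = bool-ext
  (λ 1+i<y → T-<ᵇ {i} {y} .from (<-trans (n<1+n i) (T-<ᵇ {suc i} {y} .to 1+i<y)))
  (λ i<y → T-<ᵇ {suc i} {y} .from (≤∧≢⇒< (T-<ᵇ {i} {y} .to i<y) (y≢1+i ∘ sym)))

<ᵇ1+i≡<ᵇi : ∀ i x → x ≢ i → (x <ᵇ suc i) ≡ (x <ᵇ i)
<ᵇ1+i≡<ᵇi i x x≢i = bool-ext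
  (λ x<1+i → T-<ᵇ {x} {i} .from (≤∧≢⇒< (s≤s⁻¹ (T-<ᵇ {x} {suc i} .to x<1+i)) x≢i))
  (λ x<i → T-<ᵇ {x} {suc i} .from (<-trans (T-<ᵇ {x} {i} .to x<i) (n<1+n i)))

swapFin-<ᵇ : ∀ {n} i (x y : Fin n) → suc i < n →
  ¬ (toℕ x ≡ i × toℕ y ≡ suc i) → ¬ (toℕ x ≡ suc i × toℕ y ≡ i) →
  (toℕ (swapFin i x) <ᵇ toℕ (swapFin i y)) ≡ (toℕ x <ᵇ toℕ y)
swapFin-<ᵇ i x y i+1<n ¬i,1+i ¬1+i,i with role i (toℕ x) | role i (toℕ y)
... | left p | left q
  rewrite toℕ-swapFin-left i x p i+1<n | toℕ-swapFin-left i y q i+1<n | p | q = refl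
... | left p | right q = ⊥-elim (¬i,1+i (p , q))
... | left p | fixed q q′
  rewrite toℕ-swapFin-left i x p i+1<n | swapFin-other i y q q′ | p = 1+i<ᵇ≡i<ᵇ i (toℕ y) q′
... | right p | left q = ⊥-elim (¬1+i,i (p , q))
... | right p | right q
  rewrite toℕ-swapFin-right i x p | toℕ-swapFin-right i y q | p | q = refl
... | right p | fixed q q′
  rewrite toℕ-swapFin-right i x p | swapFin-other i y q q′ | p = sym (1+i<ᵇ≡i<ᵇ i (toℕ y) q′)
... | fixed p p′ | left q
  rewrite swapFin-other i x p p′ | toℕ-swapFin-left i y q i+1<n | q = <ᵇ1+i≡<ᵇi i (toℕ x) p
... | fixed p p′ | right q
  rewrite swapFin-other i x p p′ | toℕ-swapFin-right i y q | q = sym (<ᵇ1+i≡<ᵇi i (toℕ x) p)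
... | fixed p p′ | fixed q q′
  rewrite swapFin-other i x p p′ | swapFin-other i y q q′ = refl

-- Peels off the head coordinate, mirroring the enumeration allVecs.
∑ᵛ : ∀ n m → (Vec (Fin m) n → ℕ) → ℕ
∑ᵛ zero    m f = f []
∑ᵛ (suc n) m f = ∑ᵛ n m (λ v → sum (λ x → f (x ∷ v)))

listSum-tabulate : ∀ {m} (f : Fin m → ℕ) → listSum (List.tabulate f) ≡ sum f
listSum-tabulate {zero}  f = refl
listSum-tabulate {suc m} f = cong (λ s → f zero + s) (listSum-tabulate (f ∘ suc))

listSum-concatMap : ∀ {A B : Set} (f : B → ℕ) (h : A → List B) (xs : List A) →
  listSum (List.map f (concatMap h xs)) ≡ listSum (List.map (λ x → listSum (List.map f (h x))) xs)
listSum-concatMap f h []       = refl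
listSum-concatMap f h (x ∷ xs) = begin
  listSum (List.map f (h x List.++ concatMap h xs))
    ≡⟨ cong listSum (map-++ f (h x) (concatMap h xs)) ⟩
  listSum (List.map f (h x) List.++ List.map f (concatMap h xs))
    ≡⟨ sum-++ (List.map f (h x)) _ ⟩
  listSum (List.map f (h x)) + listSum (List.map f (concatMap h xs))
    ≡⟨ cong (λ s → listSum (List.map f (h x)) + s) (listSum-concatMap f h xs) ⟩
  listSum (List.map f (h x)) + listSum (List.map (λ x → listSum (List.map f (h x))) xs) ∎
  where open ≡-Reasoning

listSum-allVecs : ∀ n m (f : Vec (Fin m) n → ℕ) → listSum (List.map f (allVecs n m)) ≡ ∑ᵛ n m f
listSum-allVecs zero    m f = +-identityʳ (f [])
listSum-allVecs (suc n) m f = begin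
  listSum (List.map f (allVecs (suc n) m))
    ≡⟨ listSum-concatMap f _ (allVecs n m) ⟩
  listSum (List.map (λ v → listSum (List.map f (List.map (_∷ v) (allFin m)))) (allVecs n m))
    ≡⟨ cong listSum (map-cong heads (allVecs n m)) ⟩
  listSum (List.map (λ v → sum (λ x → f (x ∷ v))) (allVecs n m))
    ≡⟨ listSum-allVecs n m _ ⟩
  ∑ᵛ (suc n) m f ∎
  where
  open ≡-Reasoning
  heads : ∀ v → listSum (List.map f (List.map (_∷ v) (allFin m))) ≡ sum (λ x → f (x ∷ v))
  heads v = trans (cong listSum (trans (cong (List.map f) (map-tabulate id (_∷ v)))
                                       (map-tabulate (_∷ v) f)))
                  (listSum-tabulate (λ x → f (x ∷ v)))

length-filterᵇ : ∀ {A : Set} (P : A → Bool) (xs : List A) →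
  length (filterᵇ P xs) ≡ listSum (List.map (indicator ∘ P) xs)
length-filterᵇ P []       = refl
length-filterᵇ P (x ∷ xs) with P x
... | true  = cong suc (length-filterᵇ P xs)
... | false = length-filterᵇ P xs

countList-allVecs : ∀ n m (P : Vec (Fin m) n → Bool) →
  countList P (allVecs n m) ≡ ∑ᵛ n m (indicator ∘ P)
countList-allVecs n m P = trans (length-filterᵇ P (allVecs n m)) (listSum-allVecs n m _)

∑ᵛ-cong : ∀ n m {f g : Vec (Fin m) n → ℕ} → (∀ v → f v ≡ g v) → ∑ᵛ n m f ≡ ∑ᵛ n m g
∑ᵛ-cong zero    m f≗g = f≗g []
∑ᵛ-cong (suc n) m f≗g = ∑ᵛ-cong n m (λ v → sum-cong-≗ (λ x → f≗g (x ∷ v)))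

∑ᵛ-mono : ∀ n m {f g : Vec (Fin m) n → ℕ} → (∀ v → f v ≤ g v) → ∑ᵛ n m f ≤ ∑ᵛ n m g
∑ᵛ-mono zero    m f≤g = f≤g []
∑ᵛ-mono (suc n) m f≤g = ∑ᵛ-mono n m (λ v → sum-mono (λ x → f≤g (x ∷ v)))

∑ᵛ-map-permutation : ∀ n m (π : Permutation′ m) (f : Vec (Fin m) n → ℕ) →
  ∑ᵛ n m (f ∘ Vec.map (π ⟨$⟩ʳ_)) ≡ ∑ᵛ n m f
∑ᵛ-map-permutation zero    m π f = refl
∑ᵛ-map-permutation (suc n) m π f = trans
  (∑ᵛ-cong n m (λ v → sym (∑-permute (λ x → f (x ∷ Vec.map (π ⟨$⟩ʳ_) v)) π)))
  (∑ᵛ-map-permutation n m π (λ v → sum (λ x → f (x ∷ v))))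

swapAt : ∀ {A : Set} {n} → ℕ → Vec A n → Vec A n
swapAt i       []            = []
swapAt zero    (x ∷ [])      = x ∷ []
swapAt zero    (x ∷ y ∷ v)   = y ∷ x ∷ v
swapAt (suc i) (x ∷ v)       = x ∷ swapAt i v

lookup-swapAt : ∀ {A : Set} {n} i (v : Vec A n) (j : Fin n) → lookup (swapAt i v) j ≡ lookup v (swapFin i j)
lookup-swapAt zero    (x ∷ [])    zero          = refl
lookup-swapAt zero    (x ∷ y ∷ v) zero          = refl
lookup-swapAt zero    (x ∷ y ∷ v) (suc zero)    = refl
lookup-swapAt zero    (x ∷ y ∷ v) (suc (suc j)) = refl
lookup-swapAt (suc i) (x ∷ v)     zero          = refl
lookup-swapAt (suc i) (x ∷ v)     (suc j)       = lookup-swapAt i v j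

∑ᵛ-swapAt : ∀ n m i (f : Vec (Fin m) n → ℕ) → ∑ᵛ n m (f ∘ swapAt i) ≡ ∑ᵛ n m f
∑ᵛ-swapAt zero          m i       f = refl
∑ᵛ-swapAt (suc zero)    m zero    f = refl
∑ᵛ-swapAt (suc (suc n)) m zero    f = ∑ᵛ-cong n m (λ v → ∑-comm (λ y x → f (y ∷ x ∷ v)))
∑ᵛ-swapAt (suc n)       m (suc i) f = ∑ᵛ-swapAt n m i (λ v → sum (λ x → f (x ∷ v)))

countList-allVecs-≤ : ∀ {n m} {P Q : Vec (Fin m) n → Bool} (φ : Vec (Fin m) n → Vec (Fin m) n) →
  (∀ f → ∑ᵛ n m (f ∘ φ) ≡ ∑ᵛ n m f) → (∀ v → T (P v) → T (Q (φ v))) →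
  countList P (allVecs n m) ≤ countList Q (allVecs n m)
countList-allVecs-≤ {n} {m} {P} {Q} φ φ-invariant P⇒Qφ = begin
  countList P (allVecs n m)   ≡⟨ countList-allVecs n m P ⟩
  ∑ᵛ n m (indicator ∘ P)      ≤⟨ ∑ᵛ-mono n m (λ v → indicator-mono (P⇒Qφ v)) ⟩
  ∑ᵛ n m (indicator ∘ Q ∘ φ)  ≡⟨ φ-invariant (indicator ∘ Q) ⟩
  ∑ᵛ n m (indicator ∘ Q)      ≡⟨ countList-allVecs n m Q ⟨
  countList Q (allVecs n m)   ∎
  where open ≤-Reasoning

countList-allVecs-cong : ∀ {n m} {P Q : Vec (Fin m) n → Bool} → (∀ v → T (P v) ⇔ T (Q v)) →
  countList P (allVecs n m) ≡ countList Q (allVecs n m)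
countList-allVecs-cong P⇔Q = ≤-antisym
  (countList-allVecs-≤ id (λ _ → refl) (to ∘ P⇔Q))
  (countList-allVecs-≤ id (λ _ → refl) (from ∘ P⇔Q))

_⊏_ : Cell → Cell → Bool
(a , b) ⊏ (a′ , b′) = ((a ≡ᵇ a′) ∧ (b <ᵇ b′)) ∨ ((b ≡ᵇ b′) ∧ (a <ᵇ a′))

T-inHook : ∀ a b a′ b′ → T (inHook (a , b) (a′ , b′)) ⇔ ((a′ ≡ a × b < b′) ⊎ (b′ ≡ b × a ≤ a′))
T-inHook a b a′ b′ = mk⇔
  (λ h → Data.Sum.map (λ arm → Data.Product.map (T-≡ᵇ .to) (T-<ᵇ .to) (T-∧ .to arm))
                      (λ leg → Data.Product.map (T-≡ᵇ .to) (T-≤ᵇ .to) (T-∧ .to leg)) (T-∨ .to h))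
  (λ h → T-∨ .from (Data.Sum.map (λ (p , q) → T-∧ .from (T-≡ᵇ .from p , T-<ᵇ .from q))
                                 (λ (p , q) → T-∧ .from (T-≡ᵇ .from p , T-≤ᵇ .from q)) h))

T-⊏ : ∀ a b a′ b′ → T ((a , b) ⊏ (a′ , b′)) ⇔ ((a ≡ a′ × b < b′) ⊎ (b ≡ b′ × a < a′))
T-⊏ a b a′ b′ = mk⇔
  (λ h → Data.Sum.map (λ row → Data.Product.map (T-≡ᵇ .to) (T-<ᵇ .to) (T-∧ .to row))
                      (λ col → Data.Product.map (T-≡ᵇ .to) (T-<ᵇ .to) (T-∧ .to col)) (T-∨ .to h))
  (λ h → T-∨ .from (Data.Sum.map (λ (p , q) → T-∧ .from (T-≡ᵇ .from p , T-<ᵇ .from q))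
                                 (λ (p , q) → T-∧ .from (T-≡ᵇ .from p , T-<ᵇ .from q)) h))

inHook-refl : ∀ c → T (inHook c c)
inHook-refl (a , b) = from (T-inHook a b a b) (inj₂ (refl , ≤-refl))

⊏⇒inHook : ∀ c d → T (c ⊏ d) → T (inHook c d)
⊏⇒inHook (a , b) (a′ , b′) c⊏d with to (T-⊏ a b a′ b′) c⊏d
... | inj₁ (a≡a′ , b<b′) = from (T-inHook a b a′ b′) (inj₁ (sym a≡a′ , b<b′))
... | inj₂ (b≡b′ , a<a′) = from (T-inHook a b a′ b′) (inj₂ (sym b≡b′ , <⇒≤ a<a′))

⊏-irrefl : ∀ c → ¬ T (c ⊏ c)
⊏-irrefl (a , b) c⊏c with to (T-⊏ a b a b) c⊏c
... | inj₁ (_ , b<b) = <-irrefl refl b<b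
... | inj₂ (_ , a<a) = <-irrefl refl a<a

inHook⇒⊏ : ∀ c d → T (inHook c d) → c ≢ d → T (c ⊏ d)
inHook⇒⊏ (a , b) (a′ , b′) d∈Hc c≢d with to (T-inHook a b a′ b′) d∈Hc
... | inj₁ (a′≡a , b<b′) = from (T-⊏ a b a′ b′) (inj₁ (sym a′≡a , b<b′))
... | inj₂ (b′≡b , a≤a′) with m≤n⇒m<n∨m≡n a≤a′
...   | inj₁ a<a′ = from (T-⊏ a b a′ b′) (inj₂ (sym b′≡b , a<a′))
...   | inj₂ a≡a′ = ⊥-elim (c≢d (cong₂ _,_ a≡a′ (sym b′≡b)))

-- Tableaux and types

module Tableaux {n : ℕ} (S : Vec Cell n) where

  Tableau : Set
  Tableau = Vec (Fin n) n

  hook : Fin n → Fin n → Bool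
  hook i j = inHook (lookup S i) (lookup S j)

  value : Tableau → Fin n → ℕ
  value t i = toℕ (lookup t i)

  _<[_]_ : Fin n → Tableau → Fin n → Bool
  j <[ t ] i = value t j <ᵇ value t i

  type : Tableau → Fin n → ℕ
  type t i = count (λ j → hook i j ∧ j <[ t ] i)

  IsBijective : Tableau → Set
  IsBijective t = Injective _≡_ _≡_ (lookup t)

  HasType : (Fin n → ℕ) → Tableau → Set
  HasType θ t = IsBijective t × (∀ i → type t i ≡ θ i)

  tabCount : (Fin n → ℕ) → ℕ
  tabCount θ = numTab S (+_ ∘ θ)

  hook-refl : ∀ i → T (hook i i)
  hook-refl i = inHook-refl (lookup S i)

  T-isBijᵇ : ∀ t → T (isBijᵇ t) ⇔ IsBijective t
  T-isBijᵇ t = mk⇔ to′ from′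
    where
    distinct : Fin n → Fin n → Bool
    distinct i j = does (i ≟ᶠ j) ∨ not (does (lookup t i ≟ᶠ lookup t j))
    to′ : T (isBijᵇ t) → IsBijective t
    to′ bij {i} {j} ti≡tj with T-∨ .to (T-allFinᵇ (distinct i) .to (T-allFinᵇ (allFinᵇ ∘ distinct) .to bij i) j)
    ... | inj₁ i≡j   = T-does (i ≟ᶠ j) .to i≡j
    ... | inj₂ ti≢tj = ⊥-elim (T-not-does (lookup t i ≟ᶠ lookup t j) .to ti≢tj ti≡tj)
    distinct-if-injective : IsBijective t → ∀ i j → T (distinct i j)
    distinct-if-injective inj i j with i ≟ᶠ j
    ... | yes _   = _
    ... | no  i≢j = T-∨ .from (inj₂ (T-not-does (lookup t i ≟ᶠ lookup t j) .from (i≢j ∘ inj)))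
    from′ : IsBijective t → T (isBijᵇ t)
    from′ inj = T-allFinᵇ (allFinᵇ ∘ distinct) .from λ i →
                T-allFinᵇ (distinct i) .from (distinct-if-injective inj i)

  T-hasTypeᵇ : ∀ θ t → T (hasTypeᵇ S θ t) ⇔ (∀ i → + type t i ≡ θ i)
  T-hasTypeᵇ θ t = mk⇔
    (λ has i → subst (λ x → + x ≡ θ i) (typeOf≡type i) (T-does (matches? i) .to (T-allFinᵇ _ .to has i)))
    (λ has → T-allFinᵇ (does ∘ matches?) .from λ i →
      T-does (matches? i) .from (subst (λ x → + x ≡ θ i) (sym (typeOf≡type i)) (has i)))
    where
    matches? : ∀ i → Dec (+ typeOf S t i ≡ θ i)
    matches? i = + typeOf S t i ≟ℤ θ i
    typeOf≡type : ∀ i → typeOf S t i ≡ type t i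
    typeOf≡type i = countFin≡count (λ j → hook i j ∧ j <[ t ] i)

  T-isBijᵇ∧hasTypeᵇ : ∀ θ t → T (isBijᵇ t ∧ hasTypeᵇ S (+_ ∘ θ) t) ⇔ HasType θ t
  T-isBijᵇ∧hasTypeᵇ θ t = mk⇔ to′ from′
    where
    to′ : T (isBijᵇ t ∧ hasTypeᵇ S (+_ ∘ θ) t) → HasType θ t
    to′ b = T-isBijᵇ t .to (proj₁ (T-∧ .to b)) , +-injective ∘ T-hasTypeᵇ (+_ ∘ θ) t .to (proj₂ (T-∧ .to b))
    from′ : HasType θ t → T (isBijᵇ t ∧ hasTypeᵇ S (+_ ∘ θ) t)
    from′ (bij , has) = T-∧ .from (T-isBijᵇ t .from bij , T-hasTypeᵇ (+_ ∘ θ) t .from (cong +_ ∘ has))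

  numTab-cong : ∀ {θ θ′ : Fin n → ℤ} → (∀ i → θ i ≡ θ′ i) → numTab S θ ≡ numTab S θ′
  numTab-cong {θ} {θ′} θ≗θ′ = countList-allVecs-cong λ t → mk⇔ (transport θ≗θ′ t) (transport (sym ∘ θ≗θ′) t)
    where
    transport : ∀ {θ θ′} → (∀ i → θ i ≡ θ′ i) → ∀ t →
      T (isBijᵇ t ∧ hasTypeᵇ S θ t) → T (isBijᵇ t ∧ hasTypeᵇ S θ′ t)
    transport {θ} {θ′} θ≗θ′ t b = T-∧ .from (proj₁ (T-∧ .to b) ,
      T-hasTypeᵇ θ′ t .from (λ i → trans (T-hasTypeᵇ θ t .to (proj₂ (T-∧ .to b)) i) (θ≗θ′ i)))

  tabCount-≤-along : ∀ {θ θ′} (φ : Tableau → Tableau) → (∀ f → ∑ᵛ n n (f ∘ φ) ≡ ∑ᵛ n n f) →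
    (∀ t → HasType θ t → HasType θ′ (φ t)) → tabCount θ ≤ tabCount θ′
  tabCount-≤-along {θ} {θ′} φ φ-invariant move =
    countList-allVecs-≤ φ φ-invariant (λ t → T-isBijᵇ∧hasTypeᵇ θ′ (φ t) .from ∘ move t ∘ T-isBijᵇ∧hasTypeᵇ θ t .to)

  tabCount-≡-along : ∀ {θ θ′} (φ : Tableau → Tableau) → (∀ f → ∑ᵛ n n (f ∘ φ) ≡ ∑ᵛ n n f) →
    (∀ t → HasType θ t → HasType θ′ (φ t)) → (∀ t → HasType θ′ t → HasType θ (φ t)) →
    tabCount θ ≡ tabCount θ′
  tabCount-≡-along φ φ-invariant forth back =
    ≤-antisym (tabCount-≤-along φ φ-invariant forth) (tabCount-≤-along φ φ-invariant back)

  full-hook⇒type≡value : ∀ c → (∀ j → T (hook c j)) → ∀ t → IsBijective t → type t c ≡ value t c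
  full-hook⇒type≡value c full t bij = begin
    count (λ j → hook c j ∧ j <[ t ] c)               ≡⟨ count-cong (λ j → cong (_∧ j <[ t ] c) (T-≡ .to (full j))) ⟩
    count (λ j → toℕ (lookup t j) <ᵇ value t c)       ≡⟨ count-permute (λ y → toℕ y <ᵇ value t c) (injective⇒permutation (lookup t) bij) ⟩
    count {n} (λ y → toℕ y <ᵇ value t c)              ≡⟨ count-below {n} (value t c) (<⇒≤ (toℕ<n (lookup t c))) ⟩
    value t c                                          ∎
    where open ≡-Reasoning

  IsStandard : Tableau → Set
  IsStandard t = IsBijective t × (∀ i j → T (lookup S i ⊏ lookup S j) → T (i <[ t ] j))

  T-isSYTᵇ : ∀ t → T (isSYTᵇ S t) ⇔ IsStandard t
  T-isSYTᵇ t = mk⇔ to′ from′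
    where
    implies : ∀ {b c} → T (not b) ⊎ T c → T b → T c
    implies {true} (inj₂ c) _ = c
    mono′ : ∀ i j → (T (lookup S i ⊏ lookup S j) → T (i <[ t ] j)) → T (not (lookup S i ⊏ lookup S j) ∨ (i <[ t ] j))
    mono′ i j m with lookup S i ⊏ lookup S j
    ... | true  = T-∨ .from (inj₂ (m _))
    ... | false = _
    to′ : T (isSYTᵇ S t) → IsStandard t
    to′ b = T-isBijᵇ t .to (proj₁ (T-∧ .to b)) ,
      λ i j i⊏j → implies (T-∨ .to (T-allFinᵇ _ .to (T-allFinᵇ _ .to (proj₂ (T-∧ .to b)) i) j)) i⊏j
    from′ : IsStandard t → T (isSYTᵇ S t)
    from′ (bij , increasing) = T-∧ .from (T-isBijᵇ t .from bij ,
      T-allFinᵇ _ .from λ i → T-allFinᵇ _ .from λ j → mono′ i j (increasing i j))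

  T-<[] : ∀ t j i → T (j <[ t ] i) ⇔ value t j < value t i
  T-<[] t j i = T-<ᵇ

  <[]-asym : ∀ t i j → T (i <[ t ] j) → ¬ T (j <[ t ] i)
  <[]-asym t i j i<j j<i = <-asym (T-<[] t i j .to i<j) (T-<[] t j i .to j<i)

  <[]-irrefl : ∀ t i → ¬ T (i <[ t ] i)
  <[]-irrefl t i i<i = <-irrefl refl (T-<[] t i i .to i<i)

  <[]-trans : ∀ t i j k → T (i <[ t ] j) → T (j <[ t ] k) → T (i <[ t ] k)
  <[]-trans t i j k i<j j<k = T-<[] t i k .from (<-trans (T-<[] t i j .to i<j) (T-<[] t j k .to j<k))

  <[]-connex : ∀ t → IsBijective t → ∀ i j → i ≢ j → ¬ T (i <[ t ] j) → T (j <[ t ] i)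
  <[]-connex t bij i j i≢j i≮j = T-<[] t j i .from
    (≤∧≢⇒< (≮⇒≥ (i≮j ∘ T-<[] t i j .from)) (i≢j ∘ bij ∘ toℕ-injective ∘ sym))

  standard⇔type-zero : Injective _≡_ _≡_ (lookup S) → ∀ t → IsStandard t ⇔ HasType (λ _ → 0) t
  standard⇔type-zero cells-distinct t = mk⇔ to′ from′
    where
    nothing-smaller : (∀ i j → T (lookup S i ⊏ lookup S j) → T (i <[ t ] j)) →
      ∀ i j → ¬ T (hook i j ∧ j <[ t ] i)
    nothing-smaller increasing i j smaller with T-∧ .to smaller | i ≟ᶠ j
    ... | _    , j<i | yes refl = <[]-irrefl t i j<i
    ... | j∈Hi , j<i | no  i≢j  =
      <[]-asym t i j (increasing i j (inHook⇒⊏ (lookup S i) (lookup S j) j∈Hi (i≢j ∘ cells-distinct))) j<i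
    increasing : IsBijective t → (∀ i → type t i ≡ 0) →
      ∀ i j → T (lookup S i ⊏ lookup S j) → T (i <[ t ] j)
    increasing bij type≡0 i j i⊏j = <[]-connex t bij j i (i≢j ∘ sym) j≮i
      where
      j≮i : ¬ T (j <[ t ] i)
      j≮i j<i = count≡0⇒¬T _ (type≡0 i) j (T-∧ .from (⊏⇒inHook (lookup S i) (lookup S j) i⊏j , j<i))
      i≢j : i ≢ j
      i≢j refl = ⊏-irrefl (lookup S i) i⊏j
    to′ : IsStandard t → HasType (λ _ → 0) t
    to′ (bij , increasing) = bij , λ i → count-none _ (nothing-smaller increasing i)
    from′ : HasType (λ _ → 0) t → IsStandard t
    from′ (bij , type≡0) = bij , increasing bij type≡0

  numSYT≡tabCount-zero : Injective _≡_ _≡_ (lookup S) → numSYT S ≡ tabCount (λ _ → 0)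
  numSYT≡tabCount-zero cells-distinct = countList-allVecs-cong λ t →
    ⇔-trans (T-isSYTᵇ t) (⇔-trans (standard⇔type-zero cells-distinct t) (⇔-sym (T-isBijᵇ∧hasTypeᵇ _ t)))

-- Exchanges

module Exchanges {n : ℕ} (S : Vec Cell n) where

  open Tableaux S

  swapValues : ℕ → Tableau → Tableau
  swapValues v = Vec.map (swapFin v)

  swapValues-bijective : ∀ v t → IsBijective t → IsBijective (swapValues v t)
  swapValues-bijective v t bij {i} {j} eq = bij (begin
    lookup t i                          ≡⟨ swapFin-involutive v (lookup t i) ⟨
    swapFin v (swapFin v (lookup t i))  ≡⟨ cong (swapFin v) (trans (sym (lookup-map i (swapFin v) t)) (trans eq (lookup-map j (swapFin v) t))) ⟩
    swapFin v (swapFin v (lookup t j))  ≡⟨ swapFin-involutive v (lookup t j) ⟩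
    lookup t j                          ∎)
    where open ≡-Reasoning

  -- c holds v or v + 1 and lies in no other hook, so swapping v and v + 1 preserves every
  -- comparison counted by the type of a cell i ≢ c.
  type-swapValues : ∀ v c t → IsBijective t → suc v < n → (value t c ≡ v ⊎ value t c ≡ suc v) →
    (∀ i → i ≢ c → hook i c ≡ false) → ∀ i → i ≢ c → type (swapValues v t) i ≡ type t i
  type-swapValues v c t bij 1+v<n c-holds-v c∉H i i≢c = count-cong same
    where
    at-c : ∀ {x} → value t x ≡ value t c → x ≡ c
    at-c = bij ∘ toℕ-injective
    not-both : ∀ {x y} → x ≢ c → y ≢ c → ¬ (value t x ≡ v × value t y ≡ suc v)
    not-both x≢c y≢c (x≡v , y≡1+v) = either (λ c≡v → x≢c (at-c (trans x≡v (sym c≡v))))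
                                            (λ c≡1+v → y≢c (at-c (trans y≡1+v (sym c≡1+v)))) c-holds-v
    same : ∀ j → (hook i j ∧ j <[ swapValues v t ] i) ≡ (hook i j ∧ j <[ t ] i)
    same j with j ≟ᶠ c
    ... | yes refl rewrite c∉H i i≢c = refl
    ... | no  j≢c rewrite lookup-map j (swapFin v) t | lookup-map i (swapFin v) t =
      cong (hook i j ∧_) (swapFin-<ᵇ v (lookup t j) (lookup t i) 1+v<n
        (not-both j≢c i≢c) (λ (p , q) → not-both i≢c j≢c (q , p)))

  module CornerExchange (c : Fin n) (full : ∀ j → T (hook c j)) (c∉H : ∀ i → i ≢ c → hook i c ≡ false) where

    hasType-swapValues : ∀ v → suc v < n → ∀ {θ₁ θ₂} → (∀ i → i ≢ c → θ₂ i ≡ θ₁ i) →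
      ∀ t → HasType θ₁ t → (value t c ≡ v ⊎ value t c ≡ suc v) →
      toℕ (swapFin v (lookup t c)) ≡ θ₂ c → HasType θ₂ (swapValues v t)
    hasType-swapValues v 1+v<n {θ₁} {θ₂} θ₂≗θ₁ t (bij , has) c-holds-v c-value = bij′ , has′
      where
      bij′ = swapValues-bijective v t bij
      has′ : ∀ i → type (swapValues v t) i ≡ θ₂ i
      has′ i with i ≟ᶠ c
      ... | yes refl = trans (full-hook⇒type≡value c full (swapValues v t) bij′) (trans (cong toℕ (lookup-map c (swapFin v) t)) c-value)
      ... | no  i≢c  = trans (type-swapValues v c t bij 1+v<n c-holds-v c∉H i i≢c) (trans (has i) (sym (θ₂≗θ₁ i i≢c)))

    corner-exchange : ∀ {θ θ′} v → suc v < n → θ c ≡ suc v → θ′ c ≡ v → (∀ i → i ≢ c → θ′ i ≡ θ i) →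
      tabCount θ ≡ tabCount θ′
    corner-exchange {θ} {θ′} v 1+v<n θc≡1+v θ′c≡v θ′≗θ =
      tabCount-≡-along (swapValues v) (∑ᵛ-map-permutation n n (swapFin-permutation v)) forth back
      where
      value-at-c : ∀ {θ₁} t → HasType θ₁ t → value t c ≡ θ₁ c
      value-at-c t (bij , has) = trans (sym (full-hook⇒type≡value c full t bij)) (has c)
      forth : ∀ t → HasType θ t → HasType θ′ (swapValues v t)
      forth t t∈θ = hasType-swapValues v 1+v<n θ′≗θ t t∈θ (inj₂ c-value)
        (trans (toℕ-swapFin-right v (lookup t c) c-value) (sym θ′c≡v))
        where c-value = trans (value-at-c t t∈θ) θc≡1+v
      back : ∀ t → HasType θ′ t → HasType θ (swapValues v t)
      back t t∈θ′ = hasType-swapValues v 1+v<n (sym ∘₂ θ′≗θ) t t∈θ′ (inj₁ c-value)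
        (trans (toℕ-swapFin-left v (lookup t c) c-value 1+v<n) (sym θc≡1+v))
        where c-value = trans (value-at-c t t∈θ′) θ′c≡v

  record Exchangeable (a b : Fin n) : Set where
    field
      adjacent  : toℕ b ≡ suc (toℕ a)
      same-into : ∀ j → j ≢ a → j ≢ b → hook j a ≡ hook j b
      same-from : ∀ l → l ≢ a → l ≢ b → hook a l ≡ hook b l
      b∈Ha      : hook a b ≡ true
      a∉Hb      : hook b a ≡ false

  module PositionExchange {a b : Fin n} (ex : Exchangeable a b) where

    open Exchangeable ex

    σ : Fin n → Fin n
    σ = swapFin (toℕ a)

    swapCells : Tableau → Tableau
    swapCells = swapAt (toℕ a)

    a≢b : a ≢ b
    a≢b a≡b = 1+n≢n (trans (sym adjacent) (cong toℕ (sym a≡b)))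

    σa≡b : σ a ≡ b
    σa≡b = toℕ-injective (trans (toℕ-swapFin-left (toℕ a) a refl (subst (_< n) adjacent (toℕ<n b))) (sym adjacent))

    σb≡a : σ b ≡ a
    σb≡a = toℕ-injective (toℕ-swapFin-right (toℕ a) b adjacent)

    σ-fixed : ∀ l → l ≢ a → l ≢ b → σ l ≡ l
    σ-fixed l l≢a l≢b = swapFin-other (toℕ a) l (l≢a ∘ toℕ-injective) (l≢b ∘ toℕ-injective ∘ flip trans (sym adjacent))

    data Place (l : Fin n) : Set where
      at-a      : l ≡ a → Place l
      at-b      : l ≡ b → Place l
      elsewhere : l ≢ a → l ≢ b → Place l

    place : ∀ l → Place l
    place l with l ≟ᶠ a | l ≟ᶠ b
    ... | yes l≡a | _       = at-a l≡a
    ... | no  l≢a | yes l≡b = at-b l≡b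
    ... | no  l≢a | no  l≢b = elsewhere l≢a l≢b

    lookup-swapCells : ∀ t j → lookup (swapCells t) j ≡ lookup t (σ j)
    lookup-swapCells t j = lookup-swapAt (toℕ a) t j

    swapCells-bijective : ∀ t → IsBijective t → IsBijective (swapCells t)
    swapCells-bijective t bij {i} {j} eq = begin
      i         ≡⟨ swapFin-involutive (toℕ a) i ⟨
      σ (σ i)   ≡⟨ cong σ (bij (trans (sym (lookup-swapCells t i)) (trans eq (lookup-swapCells t j)))) ⟩
      σ (σ j)   ≡⟨ swapFin-involutive (toℕ a) j ⟩
      j         ∎
      where open ≡-Reasoning

    type-swapCells : ∀ t j → type (swapCells t) j ≡ count (λ l → hook j (σ l) ∧ (value t l <ᵇ value t (σ j)))
    type-swapCells t j = trans (count-cong reindex)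
      (count-permute (λ l → hook j (σ l) ∧ (value t l <ᵇ value t (σ j))) (swapFin-permutation (toℕ a)))
      where
      reindex : ∀ l → (hook j l ∧ l <[ swapCells t ] j) ≡ (hook j (σ (σ l)) ∧ (value t (σ l) <ᵇ value t (σ j)))
      reindex l rewrite swapFin-involutive (toℕ a) l | lookup-swapCells t l | lookup-swapCells t j = refl

    type-swapCells-fixed : ∀ t j → j ≢ a → j ≢ b → type (swapCells t) j ≡ type t j
    type-swapCells-fixed t j j≢a j≢b = trans (type-swapCells t j) (count-cong same)
      where
      same : ∀ l → (hook j (σ l) ∧ (value t l <ᵇ value t (σ j))) ≡ (hook j l ∧ l <[ t ] j)
      same l rewrite σ-fixed j j≢a j≢b with place l
      ... | at-a refl rewrite σa≡b = cong (_∧ l <[ t ] j) (sym (same-into j j≢a j≢b))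
      ... | at-b refl rewrite σb≡a = cong (_∧ l <[ t ] j) (same-into j j≢a j≢b)
      ... | elsewhere l≢a l≢b rewrite σ-fixed l l≢a l≢b = refl

    type-swapCells-a : ∀ t → type (swapCells t) a ≡ type t b + indicator (a <[ t ] b)
    type-swapCells-a t = begin
      type (swapCells t) a         ≡⟨ type-swapCells t a ⟩
      count P                      ≡⟨ +-identityʳ _ ⟨
      count P + 0                  ≡⟨ cong (λ x → count P + indicator x) Qa≡false ⟨
      count P + indicator (Q a)    ≡⟨ count-update P Q a agree ⟩
      count Q + indicator (P a)    ≡⟨ cong (λ x → count Q + indicator x) Pa≡a<b ⟩
      type t b + indicator (a <[ t ] b) ∎
      where
      open ≡-Reasoning
      P Q : Fin n → Bool
      P l = hook a (σ l) ∧ (value t l <ᵇ value t (σ a))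
      Q l = hook b l ∧ l <[ t ] b
      Qa≡false : Q a ≡ false
      Qa≡false = cong (_∧ a <[ t ] b) a∉Hb
      Pa≡a<b : P a ≡ a <[ t ] b
      Pa≡a<b rewrite σa≡b | b∈Ha = refl
      agree : ∀ l → l ≢ a → P l ≡ Q l
      agree l l≢a rewrite σa≡b with place l
      ... | at-a l≡a = ⊥-elim (l≢a l≡a)
      ... | at-b refl rewrite σb≡a = cong (_∧ b <[ t ] b) (trans (T-≡ .to (hook-refl a)) (sym (T-≡ .to (hook-refl b))))
      ... | elsewhere _ l≢b rewrite σ-fixed l l≢a l≢b = cong (_∧ l <[ t ] b) (same-from l l≢a l≢b)

    type-swapCells-b : ∀ t → type (swapCells t) b + indicator (b <[ t ] a) ≡ type t a
    type-swapCells-b t = begin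
      type (swapCells t) b + indicator (b <[ t ] a)  ≡⟨ cong₂ (λ x y → x + indicator y) (type-swapCells t b) (sym Qb≡b<a) ⟩
      count P + indicator (Q b)                      ≡⟨ count-update P Q b agree ⟩
      count Q + indicator (P b)                      ≡⟨ cong (λ x → count Q + indicator x) Pb≡false ⟩
      count Q + 0                                    ≡⟨ +-identityʳ _ ⟩
      type t a                                       ∎
      where
      open ≡-Reasoning
      P Q : Fin n → Bool
      P l = hook b (σ l) ∧ (value t l <ᵇ value t (σ b))
      Q l = hook a l ∧ l <[ t ] a
      Qb≡b<a : Q b ≡ b <[ t ] a
      Qb≡b<a rewrite b∈Ha = refl
      Pb≡false : P b ≡ false
      Pb≡false rewrite σb≡a | a∉Hb = refl
      agree : ∀ l → l ≢ b → P l ≡ Q l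
      agree l l≢b rewrite σb≡a with place l
      ... | at-b l≡b = ⊥-elim (l≢b l≡b)
      ... | at-a refl rewrite σa≡b = cong (_∧ a <[ t ] a) (trans (T-≡ .to (hook-refl b)) (sym (T-≡ .to (hook-refl a))))
      ... | elsewhere l≢a _ rewrite σ-fixed l l≢a l≢b = cong (_∧ l <[ t ] a) (sym (same-from l l≢a l≢b))

    type-≤-if-a<b : ∀ t → T (a <[ t ] b) → type t a ≤ type t b
    type-≤-if-a<b t a<b = count-mono below-b
      where
      below-b : ∀ l → T (hook a l ∧ l <[ t ] a) → T (hook b l ∧ l <[ t ] b)
      below-b l below-a with T-∧ .to below-a | place l
      ... | _ , l<a | at-a refl = ⊥-elim (<[]-irrefl t a l<a)
      ... | _ , l<a | at-b refl = ⊥-elim (<[]-asym t a b a<b l<a)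
      ... | l∈Ha , l<a | elsewhere l≢a l≢b =
        T-∧ .from (subst T (same-from l l≢a l≢b) l∈Ha , <[]-trans t l a b l<a a<b)

    type-<-if-b<a : ∀ t → T (b <[ t ] a) → suc (type t b) ≤ type t a
    type-<-if-b<a t b<a = begin
      suc (type t b)                  ≡⟨ +-comm 1 _ ⟩
      type t b + 1                    ≡⟨ cong (λ x → type t b + x) (indicator-true (T-∧ .from (T-≡ .from b∈Ha , b<a))) ⟨
      type t b + indicator (Q b)      ≤⟨ count-update-≤ P Q b below-a ⟩
      type t a + indicator (P b)      ≡⟨ cong (λ x → type t a + x) (indicator-false (<[]-irrefl t b ∘ proj₂ ∘ T-∧ .to)) ⟩
      type t a + 0                    ≡⟨ +-identityʳ _ ⟩
      type t a                        ∎
      where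
      open ≤-Reasoning
      P Q : Fin n → Bool
      P l = hook b l ∧ l <[ t ] b
      Q l = hook a l ∧ l <[ t ] a
      below-a : ∀ l → l ≢ b → T (P l) → T (Q l)
      below-a l l≢b below-b with T-∧ .to below-b | place l
      ... | a∈Hb , _ | at-a refl = ⊥-elim (subst T a∉Hb a∈Hb)
      ... | _ | at-b l≡b = ⊥-elim (l≢b l≡b)
      ... | l∈Hb , l<b | elsewhere l≢a _ =
        T-∧ .from (subst T (sym (same-from l l≢a l≢b)) l∈Hb , <[]-trans t l b a l<b b<a)

    position-exchange : ∀ {θ θ′} → θ b < θ a → θ′ a ≡ θ b → θ′ b ≡ θ a ∸ 1 →
      (∀ j → j ≢ a → j ≢ b → θ′ j ≡ θ j) → tabCount θ ≡ tabCount θ′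
    position-exchange {θ} {θ′} θb<θa θ′a≡θb θ′b≡θa-1 θ′≗θ =
      tabCount-≡-along swapCells (∑ᵛ-swapAt n n (toℕ a)) forth back
      where
      open ≡-Reasoning
      1+[θa∸1]≡θa : suc (θ a ∸ 1) ≡ θ a
      1+[θa∸1]≡θa = m+[n∸m]≡n (≤-trans (s≤s z≤n) θb<θa)

      forth : ∀ t → HasType θ t → HasType θ′ (swapCells t)
      forth t (bij , has) = swapCells-bijective t bij , has′
        where
        a≮b : ¬ T (a <[ t ] b)
        a≮b a<b = <⇒≱ θb<θa (subst₂ _≤_ (has a) (has b) (type-≤-if-a<b t a<b))
        has′ : ∀ j → type (swapCells t) j ≡ θ′ j
        has′ j with place j
        ... | at-a refl = begin
          type (swapCells t) a               ≡⟨ type-swapCells-a t ⟩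
          type t b + indicator (a <[ t ] b)  ≡⟨ cong₂ _+_ (has b) (indicator-false a≮b) ⟩
          θ b + 0                            ≡⟨ +-identityʳ _ ⟩
          θ b                                ≡⟨ θ′a≡θb ⟨
          θ′ a                               ∎
        ... | at-b refl = begin
          type (swapCells t) b                               ≡⟨ m+n∸n≡m _ 1 ⟨
          type (swapCells t) b + 1 ∸ 1                       ≡⟨ cong (λ x → type (swapCells t) b + x ∸ 1) (indicator-true b<a) ⟨
          type (swapCells t) b + indicator (b <[ t ] a) ∸ 1  ≡⟨ cong (_∸ 1) (type-swapCells-b t) ⟩
          type t a ∸ 1                                       ≡⟨ cong (_∸ 1) (has a) ⟩
          θ a ∸ 1                                            ≡⟨ θ′b≡θa-1 ⟨
          θ′ b                                               ∎
          where b<a = <[]-connex t bij a b a≢b a≮b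
        ... | elsewhere j≢a j≢b = trans (type-swapCells-fixed t j j≢a j≢b) (trans (has j) (sym (θ′≗θ j j≢a j≢b)))

      back : ∀ t → HasType θ′ t → HasType θ (swapCells t)
      back t (bij , has) = swapCells-bijective t bij , has′
        where
        b≮a : ¬ T (b <[ t ] a)
        b≮a b<a = <⇒≱ θb<θa (subst₂ _≤_ (trans (cong suc (trans (has b) θ′b≡θa-1)) 1+[θa∸1]≡θa)
                                       (trans (has a) θ′a≡θb) (type-<-if-b<a t b<a))
        has′ : ∀ j → type (swapCells t) j ≡ θ j
        has′ j with place j
        ... | at-a refl = begin
          type (swapCells t) a               ≡⟨ type-swapCells-a t ⟩
          type t b + indicator (a <[ t ] b)  ≡⟨ cong₂ _+_ (trans (has b) θ′b≡θa-1) (indicator-true a<b) ⟩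
          θ a ∸ 1 + 1                        ≡⟨ +-comm _ 1 ⟩
          suc (θ a ∸ 1)                      ≡⟨ 1+[θa∸1]≡θa ⟩
          θ a                                ∎
          where a<b = <[]-connex t bij b a (a≢b ∘ sym) b≮a
        ... | at-b refl = begin
          type (swapCells t) b                           ≡⟨ +-identityʳ _ ⟨
          type (swapCells t) b + 0                       ≡⟨ cong (λ x → type (swapCells t) b + x) (indicator-false b≮a) ⟨
          type (swapCells t) b + indicator (b <[ t ] a)  ≡⟨ type-swapCells-b t ⟩
          type t a                                       ≡⟨ trans (has a) θ′a≡θb ⟩
          θ b                                            ∎
        ... | elsewhere j≢a j≢b = trans (type-swapCells-fixed t j j≢a j≢b) (trans (has j) (θ′≗θ j j≢a j≢b))

-- The hook diagram (k, 1^p)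

toℕ-reduce≥ : ∀ {m n} (i : Fin (m + n)) (i≥m : toℕ i ≥ m) → toℕ (reduce≥ i i≥m) ≡ toℕ i ∸ m
toℕ-reduce≥ {zero}  i       _    = refl
toℕ-reduce≥ {suc m} (suc i) i≥m  = toℕ-reduce≥ {m} i (s≤s⁻¹ i≥m)

+m≤+n-1⇒m<n : ∀ m n → + m ℤ.≤ + n ℤ.- 1ℤ → m < n
+m≤+n-1⇒m<n m zero    ()
+m≤+n-1⇒m<n m (suc n) (+≤+ m≤n) = s≤s m≤n

module HookDiagram (k′ p : ℕ) where

  k n : ℕ
  k = suc k′
  n = k + p

  arm : Vec Cell k
  arm = tabulate (λ j → (1 , suc (toℕ j)))

  leg : Vec Cell p
  leg = tabulate (λ j → (2 + toℕ j , 1))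

  S : Vec Cell n
  S = hookDiagram k p

  open Tableaux S
  open Exchanges S

  cell-arm : ∀ (i : Fin n) → toℕ i < k → lookup S i ≡ (1 , suc (toℕ i))
  cell-arm i i<k = begin
    lookup S i                                          ≡⟨ lookup-++-< arm leg i i<k ⟩
    lookup arm (fromℕ< i<k)                             ≡⟨ lookup∘tabulate (λ j → (1 , suc (toℕ j))) (fromℕ< i<k) ⟩
    (1 , suc (toℕ (fromℕ< i<k)))                        ≡⟨ cong (λ x → (1 , suc x)) (toℕ-fromℕ< i<k) ⟩
    (1 , suc (toℕ i))                                   ∎
    where open ≡-Reasoning

  cell-leg : ∀ (i : Fin n) → k ≤ toℕ i → lookup S i ≡ (2 + (toℕ i ∸ k) , 1)
  cell-leg i k≤i = begin
    lookup S i                                          ≡⟨ lookup-++-≥ arm leg i k≤i ⟩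
    lookup leg (reduce≥ i k≤i)                          ≡⟨ lookup∘tabulate (λ j → (2 + toℕ j , 1)) (reduce≥ i k≤i) ⟩
    (2 + toℕ (reduce≥ i k≤i) , 1)                       ≡⟨ cong (λ x → (2 + x , 1)) (toℕ-reduce≥ {k} i k≤i) ⟩
    (2 + (toℕ i ∸ k) , 1)                               ∎
    where open ≡-Reasoning

  -- Cell 0 is the corner, cells 1, …, k - 1 the rest of the first row and cells k, …, n - 1 the
  -- rest of the first column; the hook of a cell x ≠ 0 is the interval [x, segmentEnd x).
  segmentEnd : ℕ → ℕ
  segmentEnd x = if x <ᵇ k then k else n

  segmentEnd-arm : ∀ {x} → x < k → segmentEnd x ≡ k
  segmentEnd-arm x<k rewrite T-≡ .to (<⇒<ᵇ x<k) = refl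

  segmentEnd-leg : ∀ {x} → k ≤ x → segmentEnd x ≡ n
  segmentEnd-leg {x} k≤x rewrite ¬T⇒≡false {x <ᵇ k} (λ x<k → <⇒≱ (T-<ᵇ {x} {k} .to x<k) k≤x) = refl

  InHookℕ : ℕ → ℕ → Set
  InHookℕ x y = x ≡ 0 ⊎ (x ≤ y × y < segmentEnd x)

  InHookℕ⇒≤ : ∀ {x y} → InHookℕ x y → x ≤ y
  InHookℕ⇒≤ (inj₁ refl)       = z≤n
  InHookℕ⇒≤ (inj₂ (x≤y , _)) = x≤y

  T-hook : ∀ i j → T (hook i j) ⇔ InHookℕ (toℕ i) (toℕ j)
  T-hook i j with toℕ i <? k | toℕ j <? k
  ... | yes i<k | yes j<k rewrite cell-arm i i<k | cell-arm j j<k =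
    ⇔-trans (T-inHook 1 (suc (toℕ i)) 1 (suc (toℕ j))) (mk⇔
      (either (λ (_ , x<y) → inj₂ (<⇒≤ (s<s⁻¹ x<y) , y<end)) (λ (y≡x , _) → inj₂ (≤-reflexive (sym (suc-injective y≡x)) , y<end)))
      (λ h → either (λ x<y → inj₁ (refl , s<s x<y)) (λ x≡y → inj₂ (cong suc (sym x≡y) , ≤-refl)) (m≤n⇒m<n∨m≡n (InHookℕ⇒≤ h))))
    where y<end = subst (toℕ j <_) (sym (segmentEnd-arm i<k)) j<k
  ... | yes i<k | no  j≮k rewrite cell-arm i i<k | cell-leg j (≮⇒≥ j≮k) =
    ⇔-trans (T-inHook 1 (suc (toℕ i)) (2 + (toℕ j ∸ k)) 1) (mk⇔
      (either (λ ()) (λ (1≡1+x , _) → inj₁ (sym (suc-injective 1≡1+x))))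
      (either (λ x≡0 → inj₂ (cong suc (sym x≡0) , s≤s z≤n)) (λ (_ , y<end) → ⊥-elim (j≮k (subst (toℕ j <_) (segmentEnd-arm i<k) y<end)))))
  ... | no  i≮k | yes j<k rewrite cell-leg i (≮⇒≥ i≮k) | cell-arm j j<k =
    ⇔-trans (T-inHook (2 + (toℕ i ∸ k)) 1 1 (suc (toℕ j))) (mk⇔
      (either (λ ()) (λ { (_ , s≤s ()) }))
      (either (λ x≡0 → ⊥-elim (i≮k (subst (_< k) (sym x≡0) z<s))) (λ (x≤y , _) → ⊥-elim (i≮k (≤-<-trans x≤y j<k)))))
  ... | no  i≮k | no  j≮k rewrite cell-leg i (≮⇒≥ i≮k) | cell-leg j (≮⇒≥ j≮k) =
    ⇔-trans (T-inHook (2 + (toℕ i ∸ k)) 1 (2 + (toℕ j ∸ k)) 1) (mk⇔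
      (either (λ { (_ , s≤s ()) }) (λ (_ , le) → inj₂ (x≤y (s≤s⁻¹ (s≤s⁻¹ le)) , y<end)))
      (either (λ x≡0 → ⊥-elim (i≮k (subst (_< k) (sym x≡0) z<s))) (λ (x≤y , _) → inj₂ (refl , s≤s (s≤s (∸-monoˡ-≤ k x≤y))))))
    where
    y<end = subst (toℕ j <_) (sym (segmentEnd-leg (≮⇒≥ i≮k))) (toℕ<n j)
    x≤y : toℕ i ∸ k ≤ toℕ j ∸ k → toℕ i ≤ toℕ j
    x≤y le = subst₂ _≤_ (m∸n+n≡m (≮⇒≥ i≮k)) (m∸n+n≡m (≮⇒≥ j≮k)) (+-monoˡ-≤ k le)

  corner : Fin n
  corner = zero

  corner-hook-full : ∀ j → T (hook corner j)
  corner-hook-full j = T-hook corner j .from (inj₁ refl)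

  corner-not-in-hooks : ∀ i → i ≢ corner → hook i corner ≡ false
  corner-not-in-hooks i i≢0 = ¬T⇒≡false (λ i∋0 → i≢0 (toℕ-injective (n≤0⇒n≡0 (InHookℕ⇒≤ (T-hook i corner .to i∋0)))))

  cells-distinct : Injective _≡_ _≡_ (lookup S)
  cells-distinct {i} {j} Si≡Sj = toℕ-injective (≤-antisym (≤-in-hook i j Si≡Sj) (≤-in-hook j i (sym Si≡Sj)))
    where
    ≤-in-hook : ∀ i j → lookup S i ≡ lookup S j → toℕ i ≤ toℕ j
    ≤-in-hook i j Si≡Sj = InHookℕ⇒≤ (T-hook i j .to (subst (T ∘ inHook (lookup S i)) Si≡Sj (hook-refl i)))

  x<segmentEnd : ∀ {x} → x < n → x < segmentEnd x
  x<segmentEnd {x} x<n with x <? k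
  ... | yes x<k = subst (x <_) (sym (segmentEnd-arm x<k)) x<k
  ... | no  x≮k = subst (x <_) (sym (segmentEnd-leg (≮⇒≥ x≮k))) x<n

  segmentEnd≤n : ∀ x → segmentEnd x ≤ n
  segmentEnd≤n x with x <? k
  ... | yes x<k = subst (_≤ n) (sym (segmentEnd-arm x<k)) (m≤m+n k p)
  ... | no  x≮k = ≤-reflexive (segmentEnd-leg (≮⇒≥ x≮k))

  segmentEnd-suc : ∀ x → suc x ≢ k → segmentEnd (suc x) ≡ segmentEnd x
  segmentEnd-suc x 1+x≢k with x <? k
  ... | yes x<k = trans (segmentEnd-arm (≤∧≢⇒< x<k 1+x≢k)) (sym (segmentEnd-arm x<k))
  ... | no  x≮k = trans (segmentEnd-leg (≤-trans (≮⇒≥ x≮k) (n≤1+n x))) (sym (segmentEnd-leg (≮⇒≥ x≮k)))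

  hookLen-corner : hookLen S corner ≡ n
  hookLen-corner = trans (countFin≡count (hook corner)) (trans (count-cong (T-≡ .to ∘ corner-hook-full)) (count-all {n}))

  hookLen-segment : ∀ i → toℕ i ≢ 0 → hookLen S i ≤ segmentEnd (toℕ i) ∸ toℕ i
  hookLen-segment i i≢0 = subst (_≤ segmentEnd (toℕ i) ∸ toℕ i) (sym (countFin≡count (hook i)))
    (count-interval (hook i) (toℕ i) (segmentEnd (toℕ i)) in-segment)
    where
    in-segment : ∀ j → T (hook i j) → toℕ i ≤ toℕ j × toℕ j < segmentEnd (toℕ i)
    in-segment j j∈Hi with T-hook i j .to j∈Hi
    ... | inj₁ i≡0    = ⊥-elim (i≢0 i≡0)
    ... | inj₂ bounds = bounds

  -- Consecutive non-corner cells of the same segment.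
  record Neighbours (a b : Fin n) : Set where
    field
      1≤a   : 1 ≤ toℕ a
      b≡1+a : toℕ b ≡ suc (toℕ a)
      b≢k   : toℕ b ≢ k

  hook-cong : ∀ {i j i′ j′} → InHookℕ (toℕ i) (toℕ j) ⇔ InHookℕ (toℕ i′) (toℕ j′) → hook i j ≡ hook i′ j′
  hook-cong {i} {j} {i′} {j′} same = bool-ext
    (T-hook i′ j′ .from ∘ same .to ∘ T-hook i j .to) (T-hook i j .from ∘ same .from ∘ T-hook i′ j′ .to)

  module _ {a b : Fin n} (neighbours : Neighbours a b) where

    open Neighbours neighbours

    private
      1+a≢k : suc (toℕ a) ≢ k
      1+a≢k = b≢k ∘ trans b≡1+a

      1+a<n : suc (toℕ a) < n
      1+a<n = subst (_< n) b≡1+a (toℕ<n b)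

      1+a<end : suc (toℕ a) < segmentEnd (toℕ a)
      1+a<end = subst (suc (toℕ a) <_) (segmentEnd-suc (toℕ a) 1+a≢k) (x<segmentEnd 1+a<n)

      1+a≢end : ∀ y → suc (toℕ a) ≢ segmentEnd y
      1+a≢end y with y <? k
      ... | yes y<k = subst (suc (toℕ a) ≢_) (sym (segmentEnd-arm y<k)) 1+a≢k
      ... | no  y≮k = subst (suc (toℕ a) ≢_) (sym (segmentEnd-leg (≮⇒≥ y≮k))) (<⇒≢ 1+a<n)

    into-a⇔into-b : ∀ {y} → y ≢ toℕ b → InHookℕ y (toℕ a) ⇔ InHookℕ y (toℕ b)
    into-a⇔into-b {y} y≢b rewrite b≡1+a = mk⇔
      (either inj₁ (λ (y≤a , a<end) → inj₂ (≤-trans y≤a (n≤1+n (toℕ a)) , ≤∧≢⇒< a<end (1+a≢end y))))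
      (either inj₁ (λ (y≤b , b<end) → inj₂ (s≤s⁻¹ (≤∧≢⇒< y≤b y≢b) , <-trans (n<1+n (toℕ a)) b<end)))

    from-a⇔from-b : ∀ {y} → toℕ a ≢ y → InHookℕ (toℕ a) y ⇔ InHookℕ (toℕ b) y
    from-a⇔from-b {y} a≢y rewrite b≡1+a = mk⇔
      (either (λ a≡0 → ⊥-elim (<⇒≢ 1≤a (sym a≡0)))
              (λ (a≤y , y<end) → inj₂ (≤∧≢⇒< a≤y a≢y , subst (y <_) (sym (segmentEnd-suc (toℕ a) 1+a≢k)) y<end)))
      (either (λ ())
              (λ (b≤y , y<end) → inj₂ (≤-trans (n≤1+n (toℕ a)) b≤y , subst (y <_) (segmentEnd-suc (toℕ a) 1+a≢k) y<end)))

    b-in-hook-a : InHookℕ (toℕ a) (toℕ b)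
    b-in-hook-a rewrite b≡1+a = inj₂ (n≤1+n (toℕ a) , 1+a<end)

    a-not-in-hook-b : ¬ InHookℕ (toℕ b) (toℕ a)
    a-not-in-hook-b rewrite b≡1+a = either (λ ()) (λ (b≤a , _) → <-irrefl refl b≤a)

    exchangeable : Exchangeable a b
    exchangeable = record
      { adjacent  = b≡1+a
      ; same-into = λ j j≢a j≢b → hook-cong (into-a⇔into-b (j≢b ∘ toℕ-injective))
      ; same-from = λ l l≢a l≢b → hook-cong (from-a⇔from-b (l≢a ∘ toℕ-injective ∘ sym))
      ; b∈Ha      = T-≡ .to (T-hook a b .from b-in-hook-a)
      ; a∉Hb      = ¬T⇒≡false (a-not-in-hook-b ∘ T-hook b a .to)
      }

  open CornerExchange corner corner-hook-full corner-not-in-hooks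

  -- The bounds a type satisfies, in the form preserved by both exchanges.
  Bounded : (Fin n → ℕ) → Set
  Bounded θ = θ corner < n × (∀ i → toℕ i ≢ 0 → θ i + toℕ i < segmentEnd (toℕ i))

  record Reduct (θ : Fin n → ℕ) : Set where
    field
      θ′        : Fin n → ℕ
      same-count : tabCount θ ≡ tabCount θ′
      smaller   : sum θ′ < sum θ
      bounded   : Bounded θ′

  corner-step : ∀ θ v → θ corner ≡ suc v → Bounded θ → Reduct θ
  corner-step θ v θc≡1+v (θc<n , segment-bound) = record
    { θ′         = θ′
    ; same-count = corner-exchange v 1+v<n θc≡1+v θ′c≡v θ′≗θ
    ; smaller    = ≤-reflexive (+-cancelʳ-≡ v _ _ sums)
    ; bounded    = subst (_< n) (sym θ′c≡v) (<-trans (n<1+n v) 1+v<n) ,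
                   λ i i≢0 → subst (λ x → x + toℕ i < _) (sym (θ′≗θ i (i≢0 ∘ cong toℕ))) (segment-bound i i≢0)
    }
    where
    θ′ = updateAt θ corner (λ _ → v)
    1+v<n : suc v < n
    1+v<n = subst (_< n) θc≡1+v θc<n
    θ′c≡v : θ′ corner ≡ v
    θ′c≡v = updateAt-updates corner θ
    θ′≗θ : ∀ i → i ≢ corner → θ′ i ≡ θ i
    θ′≗θ i i≢c = updateAt-minimal i corner θ i≢c
    sums : suc (sum θ′) + v ≡ sum θ + v
    sums = begin
      suc (sum θ′) + v     ≡⟨ +-suc (sum θ′) v ⟨
      sum θ′ + suc v       ≡⟨ cong (λ x → sum θ′ + x) θc≡1+v ⟨
      sum θ′ + θ corner    ≡⟨ sum-update θ′ θ corner θ′≗θ ⟩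
      sum θ + θ′ corner    ≡⟨ cong (λ x → sum θ + x) θ′c≡v ⟩
      sum θ + v            ∎
      where open ≡-Reasoning

  module _ (θ : Fin n → ℕ) {a b : Fin n} (neighbours : Neighbours a b) (θb<θa : θ b < θ a) where

    open Neighbours neighbours
    open PositionExchange (exchangeable neighbours)

    private
      θ₁ : Fin n → ℕ
      θ₁ = updateAt θ a (λ _ → θ b)

    exchanged : Fin n → ℕ
    exchanged = updateAt θ₁ b (λ _ → θ a ∸ 1)

    exchanged-a : exchanged a ≡ θ b
    exchanged-a = trans (updateAt-minimal a b θ₁ a≢b) (updateAt-updates a θ)

    exchanged-b : exchanged b ≡ θ a ∸ 1
    exchanged-b = updateAt-updates b θ₁

    exchanged-other : ∀ j → j ≢ a → j ≢ b → exchanged j ≡ θ j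
    exchanged-other j j≢a j≢b = trans (updateAt-minimal j b θ₁ j≢b) (updateAt-minimal j a θ j≢a)

    private
      1+[θa∸1]≡θa : suc (θ a ∸ 1) ≡ θ a
      1+[θa∸1]≡θa = m+[n∸m]≡n (≤-trans (s≤s z≤n) θb<θa)

    sum-exchanged : sum exchanged < sum θ
    sum-exchanged = ≤-reflexive (+-cancelʳ-≡ (θ b) _ _ (begin
      suc (sum exchanged + θ b)     ≡⟨ cong (λ x → suc (sum exchanged + x)) (updateAt-minimal b a θ (a≢b ∘ sym)) ⟨
      suc (sum exchanged + θ₁ b)    ≡⟨ cong suc (sum-update exchanged θ₁ b (λ j j≢b → updateAt-minimal j b θ₁ j≢b)) ⟩
      suc (sum θ₁ + exchanged b)    ≡⟨ cong (λ x → suc (sum θ₁ + x)) exchanged-b ⟩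
      suc (sum θ₁ + (θ a ∸ 1))      ≡⟨ +-suc (sum θ₁) _ ⟨
      sum θ₁ + suc (θ a ∸ 1)        ≡⟨ cong (λ x → sum θ₁ + x) 1+[θa∸1]≡θa ⟩
      sum θ₁ + θ a                  ≡⟨ sum-update θ₁ θ a (λ j j≢a → updateAt-minimal j a θ j≢a) ⟩
      sum θ + θ₁ a                  ≡⟨ cong (λ x → sum θ + x) (updateAt-updates a θ) ⟩
      sum θ + θ b                   ∎))
      where open ≡-Reasoning

    bounded-exchanged : Bounded θ → Bounded exchanged
    bounded-exchanged (θc<n , segment-bound) =
      subst (_< n) (sym (exchanged-other corner (a≢0 ∘ cong toℕ ∘ sym) (b≢0 ∘ cong toℕ ∘ sym))) θc<n , bound
      where
      a≢0 : toℕ a ≢ 0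
      a≢0 = <⇒≢ 1≤a ∘ sym
      b≢0 : toℕ b ≢ 0
      b≢0 = 1+n≢0 ∘ trans (sym b≡1+a)
      end-b≡end-a : segmentEnd (toℕ b) ≡ segmentEnd (toℕ a)
      end-b≡end-a = trans (cong segmentEnd b≡1+a) (segmentEnd-suc (toℕ a) (b≢k ∘ trans b≡1+a))
      bound : ∀ j → toℕ j ≢ 0 → exchanged j + toℕ j < segmentEnd (toℕ j)
      bound j j≢0 with place j
      ... | at-a refl = begin-strict
        exchanged a + toℕ a         ≡⟨ cong (_+ toℕ a) exchanged-a ⟩
        θ b + toℕ a                 <⟨ +-monoʳ-< (θ b) (subst (toℕ a <_) (sym b≡1+a) (n<1+n (toℕ a))) ⟩
        θ b + toℕ b                 <⟨ segment-bound b b≢0 ⟩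
        segmentEnd (toℕ b)          ≡⟨ end-b≡end-a ⟩
        segmentEnd (toℕ a)          ∎
        where open ≤-Reasoning
      ... | at-b refl = begin-strict
        exchanged b + toℕ b         ≡⟨ cong₂ _+_ exchanged-b b≡1+a ⟩
        (θ a ∸ 1) + suc (toℕ a)     ≡⟨ +-suc _ (toℕ a) ⟩
        suc (θ a ∸ 1) + toℕ a       ≡⟨ cong (_+ toℕ a) 1+[θa∸1]≡θa ⟩
        θ a + toℕ a                 <⟨ segment-bound a a≢0 ⟩
        segmentEnd (toℕ a)          ≡⟨ end-b≡end-a ⟨
        segmentEnd (toℕ b)          ∎
        where open ≤-Reasoning
      ... | elsewhere j≢a j≢b = subst (λ x → x + toℕ j < _) (sym (exchanged-other j j≢a j≢b)) (segment-bound j j≢0)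

    chain-step : Bounded θ → Reduct θ
    chain-step θ-bounded = record
      { θ′         = exchanged
      ; same-count = position-exchange θb<θa exchanged-a exchanged-b exchanged-other
      ; smaller    = sum-exchanged
      ; bounded    = bounded-exchanged θ-bounded
      }

  -- The last cell of a segment has type 0, so walking right from a positive type meets a descent.
  descent : ∀ θ → Bounded θ → ∀ fuel (i : Fin n) → segmentEnd (toℕ i) ≤ toℕ i + fuel →
    toℕ i ≢ 0 → θ i ≢ 0 → ∃₂ λ a b → Neighbours a b × θ b < θ a
  descent θ _ zero i end≤i _ _ =
    ⊥-elim (<⇒≱ (x<segmentEnd (toℕ<n i)) (subst (segmentEnd (toℕ i) ≤_) (+-identityʳ _) end≤i))
  descent θ (θc<n , segment-bound) (suc fuel) i end≤i+fuel i≢0 θi≢0 with suc (toℕ i) ≟ segmentEnd (toℕ i)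
  ... | yes 1+i≡end = ⊥-elim (θi≢0 (n≤0⇒n≡0 (+-cancelʳ-≤ (toℕ i) (θ i) 0
          (s≤s⁻¹ (subst (θ i + toℕ i <_) (sym 1+i≡end) (segment-bound i i≢0))))))
  ... | no  1+i≢end = compare (θ b <? θ i)
    where
    1+i<n : suc (toℕ i) < n
    1+i<n = <-≤-trans (≤∧≢⇒< (x<segmentEnd (toℕ<n i)) 1+i≢end) (segmentEnd≤n (toℕ i))
    b : Fin n
    b = fromℕ< 1+i<n
    b≡1+i : toℕ b ≡ suc (toℕ i)
    b≡1+i = toℕ-fromℕ< 1+i<n
    1+i≢k : suc (toℕ i) ≢ k
    1+i≢k 1+i≡k = 1+i≢end (trans 1+i≡k (sym (segmentEnd-arm (subst (toℕ i <_) 1+i≡k (n<1+n (toℕ i))))))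
    neighbours : Neighbours i b
    neighbours = record { 1≤a = n≢0⇒n>0 i≢0 ; b≡1+a = b≡1+i ; b≢k = 1+i≢k ∘ trans (sym b≡1+i) }
    end-b≤b+fuel : segmentEnd (toℕ b) ≤ toℕ b + fuel
    end-b≤b+fuel = subst₂ _≤_ (sym (trans (cong segmentEnd b≡1+i) (segmentEnd-suc (toℕ i) 1+i≢k)))
                              (trans (+-suc (toℕ i) fuel) (cong (_+ fuel) (sym b≡1+i))) end≤i+fuel
    compare : Dec (θ b < θ i) → ∃₂ λ a b → Neighbours a b × θ b < θ a
    compare (yes θb<θi) = i , b , neighbours , θb<θi
    compare (no  θb≮θi) = descent θ (θc<n , segment-bound) fuel b end-b≤b+fuel (1+n≢0 ∘ trans (sym b≡1+i))
                            (λ θb≡0 → θi≢0 (n≤0⇒n≡0 (subst (θ i ≤_) θb≡0 (≮⇒≥ θb≮θi))))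

  step : ∀ θ → Bounded θ → (∀ i → θ i ≡ 0) ⊎ Reduct θ
  step θ bounded = by-corner-value (θ corner) refl
    where
    by-corner-value : ∀ v → θ corner ≡ v → (∀ i → θ i ≡ 0) ⊎ Reduct θ
    by-corner-value (suc v) θc≡1+v = inj₂ (corner-step θ v θc≡1+v bounded)
    by-corner-value zero    θc≡0 with all? (λ i → θ i ≟ 0)
    ... | yes all-zero = inj₁ all-zero
    ... | no  not-all  = inj₂ (uncurry from-nonzero (¬∀⟶∃¬ n (λ i → θ i ≡ 0) (λ i → θ i ≟ 0) not-all))
      where
      from-nonzero : ∀ i → θ i ≢ 0 → Reduct θ
      from-nonzero i θi≢0 =
        let a , b , neighbours , θb<θa = descent θ bounded (segmentEnd (toℕ i)) i (m≤n+m _ _) i≢0 θi≢0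
        in chain-step θ neighbours θb<θa bounded
        where
        i≢0 : toℕ i ≢ 0
        i≢0 i≡0 = θi≢0 (subst (λ j → θ j ≡ 0) (sym (toℕ-injective {i = i} {j = corner} i≡0)) θc≡0)

  reduce : ∀ fuel θ → sum θ < fuel → Bounded θ → tabCount θ ≡ tabCount (λ _ → 0)
  reduce zero       θ ()      _
  reduce (suc fuel) θ sum<fuel θ-bounded with step θ θ-bounded
  ... | inj₁ all-zero = numTab-cong (cong +_ ∘ all-zero)
  ... | inj₂ r = trans same-count (reduce fuel θ′ (<-≤-trans smaller (s≤s⁻¹ sum<fuel)) bounded)
    where open Reduct r

  bounded-if-type : ∀ θ → IsType S θ → Bounded (∣_∣ ∘ θ)
  bounded-if-type θ θ-type = subst (∣ θ corner ∣ <_) hookLen-corner (below-hookLen corner) ,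
    λ i i≢0 → subst (∣ θ i ∣ + toℕ i <_) (m∸n+n≡m (<⇒≤ (x<segmentEnd (toℕ<n i))))
      (+-monoˡ-< (toℕ i) (<-≤-trans (below-hookLen i) (hookLen-segment i i≢0)))
    where
    below-hookLen : ∀ i → ∣ θ i ∣ < hookLen S i
    below-hookLen i = +m≤+n-1⇒m<n ∣ θ i ∣ (hookLen S i)
      (subst (ℤ._≤ _) (sym (0≤i⇒+∣i∣≡i (proj₁ (θ-type i)))) (proj₂ (θ-type i)))

  numTab≡numSYT : ∀ θ → IsType S θ → numTab S θ ≡ numSYT S
  numTab≡numSYT θ θ-type = begin
    numTab S θ            ≡⟨ numTab-cong (λ i → sym (0≤i⇒+∣i∣≡i (proj₁ (θ-type i)))) ⟩
    tabCount (∣_∣ ∘ θ)    ≡⟨ reduce _ (∣_∣ ∘ θ) (n<1+n _) (bounded-if-type θ θ-type) ⟩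
    tabCount (λ _ → 0)    ≡⟨ numSYT≡tabCount-zero cells-distinct ⟨
    numSYT S              ∎
    where open ≡-Reasoning

mainTheorem6 : (k p : ℕ) → 1 ≤ k → (θ : Fin (k + p) → ℤ) → IsType (hookDiagram k p) θ
    → numTab (hookDiagram k p) θ ≡ numSYT (hookDiagram k p)
mainTheorem6 zero     p ()
mainTheorem6 (suc k′) p _ = HookDiagram.numTab≡numSYT k′ p
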